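{- Let $q$ be a prime power and let $M_3(\mathbb{F}_q)$ be the space of $3\times 3$ matrices over $\mathbb{F}_q$, with $E_{ij}$ the matrix unit having $1$ in position $(i,j)$ and $0$ elsewhere. Let $\mathrm{GL}(3,\mathbb{F}_q)\times \mathrm{GL}(3,\mathbb{F}_q)$ act on $2$-dimensional subspaces $W\le M_3(\mathbb{F}_q)$ by $W\mapsto BWC=\{BMC: M\in W\}$. For each of the three subspaces \[ W_4=\langle E_{11},E_{12}\rangle,\qquad W_7=\langle E_{13},\,E_{11}+E_{22}\rangle,\qquad W_{11}=\langle E_{11}+E_{22},\,E_{12}+E_{23}\rangle, \] there exist no $B,C\in\mathrm{GL}(3,\mathbb{F}_q)$ such that $BW_iC$ consists entirely of symmetric matrices. Equivalently, the lines $\mathrm{PG}(W_4),\mathrm{PG}(W_7),\mathrm{PG}(W_{11})$ of $\mathrm{PG}(M_3(\mathbb{F}_q))$ are not equivalent under this action to any line of $\mathrm{PG}(V_{\mathrm s})$, where $V_{\mathrm s}$ is the subspace of symmetric matrices.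
   Context: A line of $\mathrm{PG}(M_3(\mathbb{F}_q))\cong\mathrm{PG}(8,\mathbb{F}_q)$ is the projective space $\mathrm{PG}(W)$ of a $2$-dimensional subspace $W$. $V_{\mathrm s}$ denotes the $6$-dimensional space of symmetric $3\times3$ matrices over $\mathbb{F}_q$. -}

module Defs where

open import Level using (Level; _⊔_)
open import Algebra.Bundles using (CommutativeRing)
open import Data.Fin using (Fin; zero; suc)
open import Data.Nat using (ℕ)
open import Data.Product using (Σ; ∃; _×_; _,_)
open import Relation.Nullary using (¬_)

-- A finite field: additionally the carrier is enumerated (up to ≈) by Fin n for some n.
-- (Finite fields are exactly the fields F_q, q a prime power.)
module _ {c ℓ : Level} (R : CommutativeRing c ℓ) where
  open CommutativeRing R hiding (zero)

  record IsFiniteField : Set (c ⊔ ℓ) where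
    field
      1≉0     : ¬ (1# ≈ 0#)
      inverse : ∀ x → ¬ (x ≈ 0#) → Σ Carrier (λ y → x * y ≈ 1#)
      size    : ℕ
      enum    : Fin size → Carrier
      enum-surj : ∀ x → Σ (Fin size) (λ i → enum i ≈ x)

  Mat3 : Set c
  Mat3 = Fin 3 → Fin 3 → Carrier

  _≈M_ : Mat3 → Mat3 → Set ℓ
  A ≈M B = ∀ i j → A i j ≈ B i j

  _⊗_ : Mat3 → Mat3 → Mat3
  (A ⊗ B) i j = A i zero * B zero j + A i (suc zero) * B (suc zero) j
                + A i (suc (suc zero)) * B (suc (suc zero)) j

  lin : Carrier → Mat3 → Carrier → Mat3 → Mat3
  lin a M b N i j = a * M i j + b * N i j

  I3 : Mat3
  I3 i j with i Data.Fin.≟ j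
  ... | Relation.Nullary.yes _ = 1#
  ... | Relation.Nullary.no _ = 0#

  Invertible : Mat3 → Set (c ⊔ ℓ)
  Invertible B = Σ Mat3 (λ B' → (B ⊗ B') ≈M I3 × (B' ⊗ B) ≈M I3)

  Symmetric : Mat3 → Set ℓ
  Symmetric A = ∀ i j → A i j ≈ A j i

  -- matrix unit E_ij (indices 0-based: E ij here is E_{i+1,j+1} of the paper)
  E : Fin 3 → Fin 3 → Mat3
  E i j k l with i Data.Fin.≟ k | j Data.Fin.≟ l
  ... | Relation.Nullary.yes _ | Relation.Nullary.yes _ = 1#
  ... | _ | _ = 0#

  _⊕_ : Mat3 → Mat3 → Mat3
  (A ⊕ B) i j = A i j + B i j

  -- 2-dimensional subspaces given by a pair of spanning matrices
  Span2 : Set c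
  Span2 = Mat3 × Mat3

  f0 f1 f2 : Fin 3
  f0 = zero
  f1 = suc zero
  f2 = suc (suc zero)

  W4 W7 W11 : Span2
  W4  = E f0 f0 , E f0 f1
  W7  = E f0 f2 , (E f0 f0 ⊕ E f1 f1)
  W11 = (E f0 f0 ⊕ E f1 f1) , (E f0 f1 ⊕ E f1 f2)

  AllSymmetric : Mat3 → Span2 → Mat3 → Set (c ⊔ ℓ)
  AllSymmetric B (M , N) C = ∀ a b → Symmetric ((B ⊗ lin a M b N) ⊗ C)

  EquivToSymmetric : Span2 → Set (c ⊔ ℓ)
  EquivToSymmetric W = Σ Mat3 (λ B → Σ Mat3 (λ C →
    Invertible B × Invertible C × AllSymmetric B W C))

module Submission where

-- Suppose B, C ∈ GL(3) (with left inverses B′, C′) map every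
-- M ∈ W = ⟨M₁, M₂⟩ to a symmetric matrix S = B M C.  If K is a common left
-- annihilator of the generators (K Mᵢ = 0), then R = K B′ satisfies R S = 0,
-- hence S Rᵀ = (R S)ᵀ = 0 by symmetry, and so X = C Rᵀ is a common right
-- annihilator (Mᵢ X = 0).  Conversely K = R B = (C′ X)ᵀ B is recovered from X,
-- so K is "no bigger" than X:
--   * X = 0 forces K = 0;
--   * X of rank ≤ 1 (an outer product u vᵀ) forces K to have rank ≤ 1, so every
--     2×2 principal minor of K vanishes.
-- For W₇ and W₁₁ the projection E₃₃ annihilates from the left while the only
-- right annihilator is 0; for W₄ the rank-2 projection E₂₂ + E₃₃ annihilates
-- from the left while right annihilators are supported on the last row.
-- (In the code indices are 0-based as in Defs, so E₃₃ is written E₂₂ there.)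
-- The file develops 3×3 matrix algebra over an arbitrary commutative ring,
-- then the annihilator transfer and its two consequences, and finally checks
-- the concrete annihilators of the three lines.

open import Defs
open import Level using (Level; _⊔_)
open import Algebra.Bundles using (CommutativeRing)
open import Data.Fin using (Fin; zero; suc)
open import Data.Product using (Σ; ∃₂; _×_; _,_)
open import Data.Sum using (_⊎_; inj₁; inj₂)
open import Relation.Binary.Bundles using (Setoid)
open import Relation.Nullary using (¬_)
import Relation.Binary.Reasoning.Setoid as SetoidReasoning

pattern #0 = zero
pattern #1 = suc zero
pattern #2 = suc (suc zero)

fin3 : ∀ {p} {P : Fin 3 → Set p} → P #0 → P #1 → P #2 → ∀ i → P i
fin3 p₀ p₁ p₂ #0 = p₀
fin3 p₀ p₁ p₂ #1 = p₁
fin3 p₀ p₁ p₂ #2 = p₂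

module Matrices {c ℓ : Level} (F : CommutativeRing c ℓ) where
  open CommutativeRing F hiding (zero)
  open import Algebra.Solver.Ring.NaturalCoefficients.Default commutativeSemiring
    using (solve; _:+_; _:*_; _:=_)

  Mat : Set c
  Mat = Mat3 F

  Vec3 : Set c
  Vec3 = Fin 3 → Carrier

  infixl 7 _·_
  _·_ : Mat → Mat → Mat
  _·_ = _⊗_ F

  I O : Mat
  I = I3 F
  O _ _ = 0#

  infix 10 _ᵀ
  _ᵀ : Mat → Mat
  (A ᵀ) i j = A j i

  -- Entrywise equality, wrapped in a record so that the matrices are inferable.
  infix 4 _≋_
  record _≋_ (A B : Mat) : Set ℓ where
    constructor entrywise
    field entry : _≈M_ F A B
  open _≋_ public

  ≋-setoid : Setoid c ℓ
  ≋-setoid = record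
    { Carrier = Mat
    ; _≈_ = _≋_
    ; isEquivalence = record
      { refl  = entrywise λ i j → refl
      ; sym   = λ p → entrywise λ i j → sym (entry p i j)
      ; trans = λ p q → entrywise λ i j → trans (entry p i j) (entry q i j)
      }
    }
  open Setoid ≋-setoid public using () renaming (refl to ≋-refl; sym to ≋-sym)

  sum-zero : ∀ {x y z} → x ≈ 0# → y ≈ 0# → z ≈ 0# → x + y + z ≈ 0#
  sum-zero p q r = trans (+-cong (+-cong p q) r) (trans (+-identityʳ _) (+-identityʳ 0#))

  sum-only₀ : ∀ {x y z} → y ≈ 0# → z ≈ 0# → x + y + z ≈ x
  sum-only₀ q r = trans (+-cong (+-cong refl q) r) (trans (+-identityʳ _) (+-identityʳ _))

  sum-only₁ : ∀ {x y z} → x ≈ 0# → z ≈ 0# → x + y + z ≈ y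
  sum-only₁ p r = trans (+-cong (+-cong p refl) r) (trans (+-identityʳ _) (+-identityˡ _))

  sum-only₂ : ∀ {x y z} → x ≈ 0# → y ≈ 0# → x + y + z ≈ z
  sum-only₂ p q = trans (+-cong (+-cong p q) refl) (trans (+-cong (+-identityʳ 0#) refl) (+-identityˡ _))

  pickˡ : ∀ k (x : Vec3) → I k #0 * x #0 + I k #1 * x #1 + I k #2 * x #2 ≈ x k
  pickˡ #0 x = trans (sum-only₀ (zeroˡ _) (zeroˡ _)) (*-identityˡ _)
  pickˡ #1 x = trans (sum-only₁ (zeroˡ _) (zeroˡ _)) (*-identityˡ _)
  pickˡ #2 x = trans (sum-only₂ (zeroˡ _) (zeroˡ _)) (*-identityˡ _)

  pickʳ : ∀ k (x : Vec3) → x #0 * I #0 k + x #1 * I #1 k + x #2 * I #2 k ≈ x k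
  pickʳ #0 x = trans (sum-only₀ (zeroʳ _) (zeroʳ _)) (*-identityʳ _)
  pickʳ #1 x = trans (sum-only₁ (zeroʳ _) (zeroʳ _)) (*-identityʳ _)
  pickʳ #2 x = trans (sum-only₂ (zeroʳ _) (zeroʳ _)) (*-identityʳ _)

  ·-cong : ∀ {A A′ B B′} → A ≋ A′ → B ≋ B′ → A · B ≋ A′ · B′
  ·-cong p q = entrywise λ i j → +-cong (+-cong (*-cong (entry p i #0) (entry q #0 j))
    (*-cong (entry p i #1) (entry q #1 j))) (*-cong (entry p i #2) (entry q #2 j))

  infixr 7 _·≋_
  infixl 7 _≋·_
  _·≋_ : ∀ C {A B} → A ≋ B → C · A ≋ C · B
  C ·≋ p = ·-cong (≋-refl {C}) p

  _≋·_ : ∀ {A B} → A ≋ B → ∀ C → A · C ≋ B · C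
  p ≋· C = ·-cong p (≋-refl {C})

  double-sum-assoc : ∀ a₀ a₁ a₂ b₀₀ b₀₁ b₀₂ b₁₀ b₁₁ b₁₂ b₂₀ b₂₁ b₂₂ c₀ c₁ c₂ →
    (a₀ * b₀₀ + a₁ * b₁₀ + a₂ * b₂₀) * c₀ + (a₀ * b₀₁ + a₁ * b₁₁ + a₂ * b₂₁) * c₁
      + (a₀ * b₀₂ + a₁ * b₁₂ + a₂ * b₂₂) * c₂
    ≈ a₀ * (b₀₀ * c₀ + b₀₁ * c₁ + b₀₂ * c₂) + a₁ * (b₁₀ * c₀ + b₁₁ * c₁ + b₁₂ * c₂)
      + a₂ * (b₂₀ * c₀ + b₂₁ * c₁ + b₂₂ * c₂)
  double-sum-assoc = solve 15 (λ a₀ a₁ a₂ b₀₀ b₀₁ b₀₂ b₁₀ b₁₁ b₁₂ b₂₀ b₂₁ b₂₂ c₀ c₁ c₂ →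
    ((a₀ :* b₀₀ :+ a₁ :* b₁₀ :+ a₂ :* b₂₀) :* c₀ :+ (a₀ :* b₀₁ :+ a₁ :* b₁₁ :+ a₂ :* b₂₁) :* c₁
      :+ (a₀ :* b₀₂ :+ a₁ :* b₁₂ :+ a₂ :* b₂₂) :* c₂)
    := (a₀ :* (b₀₀ :* c₀ :+ b₀₁ :* c₁ :+ b₀₂ :* c₂) :+ a₁ :* (b₁₀ :* c₀ :+ b₁₁ :* c₁ :+ b₁₂ :* c₂)
      :+ a₂ :* (b₂₀ :* c₀ :+ b₂₁ :* c₁ :+ b₂₂ :* c₂))) refl

  ·-assoc : ∀ A B C → (A · B) · C ≋ A · (B · C)
  ·-assoc A B C = entrywise λ i j → double-sum-assoc
    (A i #0) (A i #1) (A i #2) (B #0 #0) (B #0 #1) (B #0 #2) (B #1 #0) (B #1 #1) (B #1 #2)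
    (B #2 #0) (B #2 #1) (B #2 #2) (C #0 j) (C #1 j) (C #2 j)

  ·-identityˡ : ∀ A → I · A ≋ A
  ·-identityˡ A = entrywise λ i j → pickˡ i (λ k → A k j)

  ·-identityʳ : ∀ A → A · I ≋ A
  ·-identityʳ A = entrywise λ i j → pickʳ j (A i)

  ·-zeroˡ : ∀ A → O · A ≋ O
  ·-zeroˡ A = entrywise λ i j → sum-zero (zeroˡ _) (zeroˡ _) (zeroˡ _)

  ·-zeroʳ : ∀ A → A · O ≋ O
  ·-zeroʳ A = entrywise λ i j → sum-zero (zeroʳ _) (zeroʳ _) (zeroʳ _)

  ᵀ-cong : ∀ {A B} → A ≋ B → A ᵀ ≋ B ᵀ
  ᵀ-cong p = entrywise λ i j → entry p j i

  symmetric-·ᵀ : ∀ S R → Symmetric F S → S · R ᵀ ≋ (R · S) ᵀ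
  symmetric-·ᵀ S R sym-S = entrywise λ i j → +-cong (+-cong (swap i j #0) (swap i j #1)) (swap i j #2)
    where
    swap : ∀ i j k → S i k * R j k ≈ R j k * S k i
    swap i j k = trans (*-cong (sym-S i k) refl) (*-comm (S k i) (R j k))

  lin-first : ∀ M N → lin F 1# M 0# N ≋ M
  lin-first M N = entrywise λ i j → trans (+-cong (*-identityˡ _) (zeroˡ _)) (+-identityʳ _)

  lin-second : ∀ M N → lin F 0# M 1# N ≋ N
  lin-second M N = entrywise λ i j → trans (+-cong (zeroˡ _) (*-identityˡ _)) (+-identityˡ _)

  symmetric-resp : ∀ {A B} → A ≋ B → Symmetric F A → Symmetric F B
  symmetric-resp p sym-A i j = trans (sym (entry p i j)) (trans (sym-A i j) (entry p j i))

  cancelˡ : ∀ B′ B A → B′ · B ≋ I → B′ · (B · A) ≋ A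
  cancelˡ B′ B A B′B = begin
    B′ · (B · A)  ≈⟨ ≋-sym (·-assoc B′ B A) ⟩
    (B′ · B) · A  ≈⟨ B′B ≋· A ⟩
    I · A         ≈⟨ ·-identityˡ A ⟩
    A             ∎
    where open SetoidReasoning ≋-setoid

  basisRow : ∀ A X i k → (∀ l → A i l ≈ I k l) → ∀ j → (A · X) i j ≈ X k j
  basisRow A X i k row j = trans (+-cong (+-cong (*-cong (row #0) refl) (*-cong (row #1) refl))
    (*-cong (row #2) refl)) (pickˡ k (λ l → X l j))

  annihilatedRow : ∀ A X i k → A · X ≋ O → (∀ l → A i l ≈ I k l) → ∀ j → X k j ≈ 0#
  annihilatedRow A X i k AX row j = trans (sym (basisRow A X i k row j)) (entry AX i j)

  annihilate : ∀ K M → (∀ k → (∀ i → K i k ≈ 0#) ⊎ (∀ j → M k j ≈ 0#)) → K · M ≋ O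
  annihilate K M support = entrywise λ i j → sum-zero (term i j #0) (term i j #1) (term i j #2)
    where
    term : ∀ i j k → K i k * M k j ≈ 0#
    term i j k with support k
    ... | inj₁ column = trans (*-cong (column i) refl) (zeroˡ _)
    ... | inj₂ row    = trans (*-cong refl (row j)) (zeroʳ _)

  outer : Vec3 → Vec3 → Mat
  outer u v i j = u i * v j

  _▹_ : Mat → Vec3 → Vec3
  (A ▹ u) i = A i #0 * u #0 + A i #1 * u #1 + A i #2 * u #2

  _◃_ : Vec3 → Mat → Vec3
  (v ◃ A) j = v #0 * A #0 j + v #1 * A #1 j + v #2 * A #2 j

  ·-outer : ∀ A u v → A · outer u v ≋ outer (A ▹ u) v
  ·-outer A u v = entrywise λ i j → law (A i #0) (A i #1) (A i #2) (u #0) (u #1) (u #2) (v j)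
    where
    law : ∀ a₀ a₁ a₂ u₀ u₁ u₂ w →
      a₀ * (u₀ * w) + a₁ * (u₁ * w) + a₂ * (u₂ * w) ≈ (a₀ * u₀ + a₁ * u₁ + a₂ * u₂) * w
    law = solve 7 (λ a₀ a₁ a₂ u₀ u₁ u₂ w →
      a₀ :* (u₀ :* w) :+ a₁ :* (u₁ :* w) :+ a₂ :* (u₂ :* w) := (a₀ :* u₀ :+ a₁ :* u₁ :+ a₂ :* u₂) :* w) refl

  outer-· : ∀ u v A → outer u v · A ≋ outer u (v ◃ A)
  outer-· u v A = entrywise λ i j → law (u i) (v #0) (v #1) (v #2) (A #0 j) (A #1 j) (A #2 j)
    where
    law : ∀ w v₀ v₁ v₂ a₀ a₁ a₂ →
      w * v₀ * a₀ + w * v₁ * a₁ + w * v₂ * a₂ ≈ w * (v₀ * a₀ + v₁ * a₁ + v₂ * a₂)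
    law = solve 7 (λ w v₀ v₁ v₂ a₀ a₁ a₂ →
      w :* v₀ :* a₀ :+ w :* v₁ :* a₁ :+ w :* v₂ :* a₂ := w :* (v₀ :* a₀ :+ v₁ :* a₁ :+ v₂ :* a₂)) refl

  outerᵀ : ∀ u v → (outer u v) ᵀ ≋ outer v u
  outerᵀ u v = entrywise λ i j → *-comm (u j) (v i)

  rankOne-minor : ∀ {K} u v → K ≋ outer u v → ∀ i j → K i i * K j j ≈ K i j * K j i
  rankOne-minor u v p i j = trans (*-cong (entry p i i) (entry p j j))
    (trans (law (u i) (u j) (v i) (v j)) (sym (*-cong (entry p i j) (entry p j i))))
    where
    law : ∀ a b x y → (a * x) * (b * y) ≈ (a * y) * (b * x)
    law = solve 4 (λ a b x y → (a :* x) :* (b :* y) := (a :* y) :* (b :* x)) refl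

module Obstruction {c ℓ : Level} (F : CommutativeRing c ℓ) where
  open CommutativeRing F hiding (zero)
  open Matrices F
  open SetoidReasoning ≋-setoid

  -- K factors through X: K = (P X)ᵀ Q for some matrices P, Q.  Such K is no
  -- larger than X; the two instances of this used below are X = 0 and rank X ≤ 1.
  FactorsThrough : Mat → Mat → Set (c ⊔ ℓ)
  FactorsThrough K X = Σ Mat λ P → Σ Mat λ Q → K ≋ (P · X) ᵀ · Q

  factorsThrough-resp : ∀ {K X Y} → X ≋ Y → FactorsThrough K X → FactorsThrough K Y
  factorsThrough-resp {K} {X} {Y} X≋Y (P , Q , K≋) = P , Q , (begin
    K             ≈⟨ K≋ ⟩
    (P · X) ᵀ · Q ≈⟨ ᵀ-cong (P ·≋ X≋Y) ≋· Q ⟩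
    (P · Y) ᵀ · Q ∎)

  factorsThrough-zero : ∀ {K} → FactorsThrough K O → K ≋ O
  factorsThrough-zero {K} (P , Q , K≋) = begin
    K             ≈⟨ K≋ ⟩
    (P · O) ᵀ · Q ≈⟨ ᵀ-cong (·-zeroʳ P) ≋· Q ⟩
    O · Q         ≈⟨ ·-zeroˡ Q ⟩
    O             ∎

  -- (P u vᵀ)ᵀ Q = v ((P u)ᵀ Q): factoring through a rank-one matrix gives rank one.
  factorsThrough-rankOne : ∀ {K} u v → FactorsThrough K (outer u v) → ∃₂ λ a b → K ≋ outer a b
  factorsThrough-rankOne {K} u v (P , Q , K≋) = v , (P ▹ u) ◃ Q , (begin
    K                       ≈⟨ K≋ ⟩
    (P · outer u v) ᵀ · Q   ≈⟨ ᵀ-cong (·-outer P u v) ≋· Q ⟩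
    (outer (P ▹ u) v) ᵀ · Q ≈⟨ outerᵀ (P ▹ u) v ≋· Q ⟩
    outer v (P ▹ u) · Q     ≈⟨ outer-· v (P ▹ u) Q ⟩
    outer v ((P ▹ u) ◃ Q)   ∎)

  -- If B′B = I and S = B M C is symmetric, then a left
  -- annihilator K of M gives the right annihilator C (K B′)ᵀ of M: with R = K B′
  -- we have R S = K M C = 0, so S Rᵀ = (R S)ᵀ = 0 and M C Rᵀ = B′ S Rᵀ = 0.
  transferredAnnihilator : ∀ B B′ C M K → B′ · B ≋ I → Symmetric F ((B · M) · C) →
    K · M ≋ O → M · (C · (K · B′) ᵀ) ≋ O
  transferredAnnihilator B B′ C M K B′B sym-S KM = begin
    M · (C · R ᵀ)  ≈⟨ ≋-sym (·-assoc M C (R ᵀ)) ⟩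
    (M · C) · R ᵀ  ≈⟨ ≋-sym B′S ≋· R ᵀ ⟩
    (B′ · S) · R ᵀ ≈⟨ ·-assoc B′ S (R ᵀ) ⟩
    B′ · (S · R ᵀ) ≈⟨ B′ ·≋ symmetric-·ᵀ S R sym-S ⟩
    B′ · (R · S) ᵀ ≈⟨ B′ ·≋ ᵀ-cong RS ⟩
    B′ · O         ≈⟨ ·-zeroʳ B′ ⟩
    O              ∎
    where
    S R : Mat
    S = (B · M) · C
    R = K · B′

    B′S : B′ · S ≋ M · C
    B′S = begin
      B′ · ((B · M) · C) ≈⟨ B′ ·≋ ·-assoc B M C ⟩
      B′ · (B · (M · C)) ≈⟨ cancelˡ B′ B (M · C) B′B ⟩
      M · C              ∎

    RS : R · S ≋ O
    RS = begin
      (K · B′) · S ≈⟨ ·-assoc K B′ S ⟩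
      K · (B′ · S) ≈⟨ K ·≋ B′S ⟩
      K · (M · C)  ≈⟨ ≋-sym (·-assoc K M C) ⟩
      (K · M) · C  ≈⟨ KM ≋· C ⟩
      O · C        ≈⟨ ·-zeroˡ C ⟩
      O            ∎

  -- K is recovered from the transferred annihilator: K = (K B′) B = (C′ C (K B′)ᵀ)ᵀ B.
  recoveredAnnihilator : ∀ B B′ C C′ K → B′ · B ≋ I → C′ · C ≋ I →
    FactorsThrough K (C · (K · B′) ᵀ)
  recoveredAnnihilator B B′ C C′ K B′B C′C = C′ , B , (begin
    K                            ≈⟨ ≋-sym (·-identityʳ K) ⟩
    K · I                        ≈⟨ K ·≋ ≋-sym B′B ⟩
    K · (B′ · B)                 ≈⟨ ≋-sym (·-assoc K B′ B) ⟩
    ((K · B′) ᵀ) ᵀ · B           ≈⟨ ᵀ-cong (≋-sym (cancelˡ C′ C ((K · B′) ᵀ) C′C)) ≋· B ⟩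
    (C′ · (C · (K · B′) ᵀ)) ᵀ · B ∎)

  annihilatorTransfer : ∀ M N → EquivToSymmetric F (M , N) → ∀ K → K · M ≋ O → K · N ≋ O →
    Σ Mat λ X → M · X ≋ O × N · X ≋ O × FactorsThrough K X
  annihilatorTransfer M N (B , C , (B′ , _ , B′B) , (C′ , _ , C′C) , allSym) K KM KN =
    C · (K · B′) ᵀ ,
    transferredAnnihilator B B′ C M K left-inverse-B sym-M KM ,
    transferredAnnihilator B B′ C N K left-inverse-B sym-N KN ,
    recoveredAnnihilator B B′ C C′ K left-inverse-B left-inverse-C
    where
    left-inverse-B : B′ · B ≋ I
    left-inverse-B = entrywise B′B
    left-inverse-C : C′ · C ≋ I
    left-inverse-C = entrywise C′C
    sym-M : Symmetric F ((B · M) · C)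
    sym-M = symmetric-resp first (allSym 1# 0#)
      where
      first : (B · lin F 1# M 0# N) · C ≋ (B · M) · C
      first = (B ·≋ lin-first M N) ≋· C
    sym-N : Symmetric F ((B · N) · C)
    sym-N = symmetric-resp second (allSym 0# 1#)
      where
      second : (B · lin F 0# M 1# N) · C ≋ (B · N) · C
      second = (B ·≋ lin-second M N) ≋· C

  noSymmetricImage-zero : ∀ M N K → ¬ K ≋ O → K · M ≋ O → K · N ≋ O →
    (∀ X → M · X ≋ O → N · X ≋ O → X ≋ O) → ¬ EquivToSymmetric F (M , N)
  noSymmetricImage-zero M N K K≉O KM KN onlyZero equiv =
    let (X , MX , NX , factors) = annihilatorTransfer M N equiv K KM KN
    in K≉O (factorsThrough-zero (factorsThrough-resp (onlyZero X MX NX) factors))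

  noSymmetricImage-rankOne : ∀ M N K i j → ¬ (K i i * K j j ≈ K i j * K j i) →
    K · M ≋ O → K · N ≋ O → (∀ X → M · X ≋ O → N · X ≋ O → ∃₂ λ u v → X ≋ outer u v) →
    ¬ EquivToSymmetric F (M , N)
  noSymmetricImage-rankOne M N K i j minor≉ KM KN rankOne equiv =
    let (X , MX , NX , factors) = annihilatorTransfer M N equiv K KM KN
        (u , v , X≋) = rankOne X MX NX
        (a , b , K≋) = factorsThrough-rankOne u v (factorsThrough-resp X≋ factors)
    in minor≉ (rankOne-minor a b K≋ i j)

module Lines {c ℓ : Level} (F : CommutativeRing c ℓ) where
  open CommutativeRing F hiding (zero)
  open Matrices F
  open Obstruction F

  infixl 6 _⊞_
  _⊞_ : Mat → Mat → Mat
  _⊞_ = _⊕_ F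

  E₀₀ E₀₁ E₀₂ E₁₁ E₁₂ E₂₂ : Mat
  E₀₀ = E F #0 #0
  E₀₁ = E F #0 #1
  E₀₂ = E F #0 #2
  E₁₁ = E F #1 #1
  E₁₂ = E F #1 #2
  E₂₂ = E F #2 #2

  E₂₂-annihilates : ∀ M → (∀ j → M #2 j ≈ 0#) → E₂₂ · M ≋ O
  E₂₂-annihilates M row₂ =
    annihilate E₂₂ M (fin3 (inj₁ (fin3 refl refl refl)) (inj₁ (fin3 refl refl refl)) (inj₂ row₂))

  E₁₁+E₂₂-annihilates : ∀ M → (∀ j → M #1 j ≈ 0#) → (∀ j → M #2 j ≈ 0#) → (E₁₁ ⊞ E₂₂) · M ≋ O
  E₁₁+E₂₂-annihilates M row₁ row₂ =
    annihilate (E₁₁ ⊞ E₂₂) M (fin3 (inj₁ (fin3 0+0 0+0 0+0)) (inj₂ row₁) (inj₂ row₂))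
    where
    0+0 : 0# + 0# ≈ 0#
    0+0 = +-identityʳ 0#

  E₂₂≉O : ¬ 1# ≈ 0# → ¬ E₂₂ ≋ O
  E₂₂≉O 1≉0 E₂₂≋O = 1≉0 (entry E₂₂≋O #2 #2)

  E₁₁+E₂₂-minor : ¬ 1# ≈ 0# →
    ¬ ((E₁₁ ⊞ E₂₂) #1 #1 * (E₁₁ ⊞ E₂₂) #2 #2 ≈ (E₁₁ ⊞ E₂₂) #1 #2 * (E₁₁ ⊞ E₂₂) #2 #1)
  E₁₁+E₂₂-minor 1≉0 minor = 1≉0 (begin
    1#                        ≈⟨ sym (*-identityˡ 1#) ⟩
    1# * 1#                   ≈⟨ sym (*-cong (+-identityʳ 1#) (+-identityˡ 1#)) ⟩
    (1# + 0#) * (0# + 1#)     ≈⟨ minor ⟩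
    (0# + 0#) * (0# + 0#)     ≈⟨ *-cong (+-identityʳ 0#) (+-identityʳ 0#) ⟩
    0# * 0#                   ≈⟨ zeroˡ 0# ⟩
    0#                        ∎)
    where open SetoidReasoning setoid

  W₇-rightAnnihilator : ∀ X → E₀₂ · X ≋ O → (E₀₀ ⊞ E₁₁) · X ≋ O → X ≋ O
  W₇-rightAnnihilator X kills₁ kills₂ = entrywise (fin3
    (annihilatedRow (E₀₀ ⊞ E₁₁) X #0 #0 kills₂ (fin3 (+-identityʳ _) (+-identityʳ _) (+-identityʳ _)))
    (annihilatedRow (E₀₀ ⊞ E₁₁) X #1 #1 kills₂ (fin3 (+-identityˡ _) (+-identityˡ _) (+-identityˡ _)))
    (annihilatedRow E₀₂ X #0 #2 kills₁ (fin3 refl refl refl)))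

  W₁₁-rightAnnihilator : ∀ X → (E₀₀ ⊞ E₁₁) · X ≋ O → (E₀₁ ⊞ E₁₂) · X ≋ O → X ≋ O
  W₁₁-rightAnnihilator X kills₁ kills₂ = entrywise (fin3
    (annihilatedRow (E₀₀ ⊞ E₁₁) X #0 #0 kills₁ (fin3 (+-identityʳ _) (+-identityʳ _) (+-identityʳ _)))
    (annihilatedRow (E₀₀ ⊞ E₁₁) X #1 #1 kills₁ (fin3 (+-identityˡ _) (+-identityˡ _) (+-identityˡ _)))
    (annihilatedRow (E₀₁ ⊞ E₁₂) X #1 #2 kills₂ (fin3 (+-identityˡ _) (+-identityˡ _) (+-identityˡ _))))

  -- A common right annihilator of W₄ lives in the last row, so it is e₂ vᵀ.
  W₄-rightAnnihilator : ∀ X → E₀₀ · X ≋ O → E₀₁ · X ≋ O → ∃₂ λ u v → X ≋ outer u v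
  W₄-rightAnnihilator X kills₁ kills₂ = I #2 , X #2 , entrywise (fin3
    (λ j → trans (annihilatedRow E₀₀ X #0 #0 kills₁ (fin3 refl refl refl) j) (sym (zeroˡ _)))
    (λ j → trans (annihilatedRow E₀₁ X #0 #1 kills₂ (fin3 refl refl refl) j) (sym (zeroˡ _)))
    (λ j → sym (*-identityˡ _)))

  W₄-notSymmetric : ¬ 1# ≈ 0# → ¬ EquivToSymmetric F (W4 F)
  W₄-notSymmetric 1≉0 = noSymmetricImage-rankOne E₀₀ E₀₁ (E₁₁ ⊞ E₂₂) #1 #2 (E₁₁+E₂₂-minor 1≉0)
    (E₁₁+E₂₂-annihilates E₀₀ (λ j → refl) (λ j → refl))
    (E₁₁+E₂₂-annihilates E₀₁ (λ j → refl) (λ j → refl))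
    W₄-rightAnnihilator

  W₇-notSymmetric : ¬ 1# ≈ 0# → ¬ EquivToSymmetric F (W7 F)
  W₇-notSymmetric 1≉0 = noSymmetricImage-zero E₀₂ (E₀₀ ⊞ E₁₁) E₂₂ (E₂₂≉O 1≉0)
    (E₂₂-annihilates E₀₂ (λ j → refl))
    (E₂₂-annihilates (E₀₀ ⊞ E₁₁) (λ j → +-identityʳ _))
    W₇-rightAnnihilator

  W₁₁-notSymmetric : ¬ 1# ≈ 0# → ¬ EquivToSymmetric F (W11 F)
  W₁₁-notSymmetric 1≉0 = noSymmetricImage-zero (E₀₀ ⊞ E₁₁) (E₀₁ ⊞ E₁₂) E₂₂ (E₂₂≉O 1≉0)
    (E₂₂-annihilates (E₀₀ ⊞ E₁₁) (λ j → +-identityʳ _))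
    (E₂₂-annihilates (E₀₁ ⊞ E₁₂) (λ j → +-identityʳ _))
    W₁₁-rightAnnihilator

mainTheorem1 : {c ℓ : Level} (F : CommutativeRing c ℓ) → IsFiniteField F →
    ¬ EquivToSymmetric F (W4 F) × ¬ EquivToSymmetric F (W7 F) × ¬ EquivToSymmetric F (W11 F)
mainTheorem1 F finite = W₄-notSymmetric 1≉0 , W₇-notSymmetric 1≉0 , W₁₁-notSymmetric 1≉0
  where
  open Lines F
  open CommutativeRing F using (_≈_; 1#; 0#)
  1≉0 : ¬ 1# ≈ 0#
  1≉0 = IsFiniteField.1≉0 finite
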